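{- Let $P$ be a Laurent polynomial in $x_1,\ldots,x_r$ with integer coefficients, $p$ a prime, $a\geq1$, and let $\tilde P$ be as defined in the context (relative to $p^a$). Then there exists $n_0\in\mathbb{N}$ with $p\mid\mathrm{ct}(P^{n_0})$ if and only if there exists $n_1\in\mathbb{N}$ with $p\mid\mathrm{ct}(\tilde P^{n_1})$. Furthermore, if such $n_0$ exists, one can take $n_1=n_0$.
   Context: $\mathrm{ct}(Q)$ denotes the constant term of a Laurent polynomial $Q$. $\tilde P$ is the Laurent polynomial with coefficients in $\mathbb{Z}/p^a\mathbb{Z}$ such that $P(x_1,\ldots,x_r)^{p^{a-1}}\equiv\tilde P(x_1^{p^\ell},\ldots,x_r^{p^\ell})\pmod{p^a}$, where $\ell$ is taken as large as possible. (Divisibility of $\mathrm{ct}(\tilde P^{n})\in\mathbb{Z}/p^a\mathbb{Z}$ by $p$ is meaningful.) -}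

module Defs where

open import Data.Nat as ℕ using (ℕ; zero; suc; _∸_)
open import Data.Integer as ℤ using (ℤ; +_; _-_)
open import Data.Integer.Divisibility using (_∣_)
open import Data.List using (List; []; _∷_; map; concatMap)
open import Data.Product using (_×_; _,_)
open import Data.Vec using (Vec; replicate; zipWith)
import Data.Vec.Properties as VecP
open import Relation.Nullary using (yes; no)

-- A Laurent polynomial in r variables x_1..x_r with integer coefficients,
-- represented as a finite formal sum of monomials  c · x^e  with e ∈ ℤ^r.
-- Repeated exponents are allowed; the actual coefficient is their sum.
LPoly : ℕ → Set
LPoly r = List (Vec ℤ r × ℤ)

coeff : ∀ {r} → LPoly r → Vec ℤ r → ℤ
coeff [] e = + 0
coeff ((e' , c) ∷ P) e with VecP.≡-dec ℤ._≟_ e' e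
... | yes _ = c ℤ.+ coeff P e
... | no  _ = coeff P e

ct : ∀ {r} → LPoly r → ℤ
ct {r} P = coeff P (replicate r (+ 0))

one : ∀ {r} → LPoly r
one {r} = (replicate r (+ 0) , + 1) ∷ []

_·_ : ∀ {r} → LPoly r → LPoly r → LPoly r
P · Q = concatMap (λ { (e , c) → map (λ { (f , d) → (zipWith ℤ._+_ e f , c ℤ.* d) }) Q }) P

_^^_ : ∀ {r} → LPoly r → ℕ → LPoly r
P ^^ zero  = one
P ^^ suc n = P · (P ^^ n)

subsPow : ∀ {r} → ℕ → LPoly r → LPoly r
subsPow k Q = map (λ { (e , c) → (Data.Vec.map (λ z → (+ k) ℤ.* z) e , c) }) Q

_≡_[mod_] : ℤ → ℤ → ℕ → Set
x ≡ y [mod m ] = (+ m) ∣ (x - y)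

-- Q (with coefficients read in ℤ/p^aℤ via integer lifts) satisfies
--   P(x)^{p^{a-1}} ≡ Q(x_1^{p^ℓ},…,x_r^{p^ℓ})  (mod p^a)  coefficientwise
ReprAt : ∀ {r} → (p a : ℕ) → LPoly r → (ℓ : ℕ) → LPoly r → Set
ReprAt {r} p a P ℓ Q =
  ∀ (e : Vec ℤ r) →
    coeff (P ^^ (p ℕ.^ (a ∸ 1))) e ≡ coeff (subsPow (p ℕ.^ ℓ) Q) e [mod p ℕ.^ a ]

IsTilde : ∀ {r} → (p a : ℕ) → LPoly r → (ℓ : ℕ) → LPoly r → Set
IsTilde {r} p a P ℓ Q =
  ReprAt p a P ℓ Q × (∀ (ℓ' : ℕ) (Q' : LPoly r) → ReprAt p a P ℓ' Q' → ℓ' ℕ.≤ ℓ)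

-- Modulo p, P(x)^p ≡ P(x^p) coefficientwise: this is the freshman's dream in the semiring of
-- Laurent polynomials together with Fermat's little theorem for the coefficients. Since the
-- substitution x ↦ x^k (k ≠ 0) is multiplicative and keeps the constant term, iterating gives
-- ct(P^(p^j n)) ≡ ct(P^n) (mod p). With j = a - 1 and P^(p^(a-1)) ≡ P̃(x^(p^ℓ)) (mod p^a) this
-- yields ct(P^n) ≡ ct(P̃^n) (mod p) for every n, so p divides both or neither, with the same n.
module Submission where

open import Defs

open import Algebra.Bundles using (CommutativeSemiring)
open import Algebra.Structures using (IsCommutativeMonoid)
open import Algebra.Structures.Biased using (IsCommutativeSemiringˡ)
open import Data.Fin using (Fin; zero; suc; toℕ; fromℕ; inject₁)
open import Data.Fin.Properties using (toℕ-fromℕ; inject₁ℕ<)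
import Data.Integer as ℤ
import Data.Integer.Properties as ℤP
open import Data.Integer.Divisibility.Signed as Signed using (divides; ∣ᵤ⇒∣; ∣⇒∣ᵤ)
import Data.Integer.Divisibility as ℤD
import Relation.Binary.Reasoning.Setoid
open import Data.Integer.Tactic.RingSolver using (solve-∀)
open import Data.Nat as ℕ using (ℕ; zero; suc; _∸_; _<_; _!; z≤n; s≤s)
import Data.Nat.Properties as ℕP
import Data.Nat.Divisibility as ℕD
open import Data.Nat.Combinatorics using (_C_; nCn≡1; k![n∸k]!∣n!)
open import Data.Nat.Combinatorics.Specification using (nCk≡n!/k![n-k]!)
open import Data.Nat.DivMod using (m/n*n≡m)
open import Data.Nat.Primality using (Prime; euclidsLemma; ¬prime[1]; prime⇒nonZero)
open import Data.List using ([]; _∷_; _++_; map)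
import Data.List.Properties as ListP
open import Data.Product using (∃; _,_)
open import Function.Bundles using (_⇔_; mk⇔)
open import Data.Vec as V using (Vec; []; _∷_; replicate; zipWith)
import Data.Vec.Properties as VecP
open import Data.Sum using (inj₁; inj₂)
open import Level using (0ℓ)
open import Relation.Binary.Bundles using (Setoid)
open import Relation.Binary.Structures using (IsEquivalence)
import Relation.Binary.PropositionalEquality as ≡
open import Relation.Nullary using (¬_; contradiction; yes; no)

prime∤! : ∀ {p} → Prime p → ∀ {m} → m < p → ¬ (p ℕD.∣ m !)
prime∤! p-prime {zero} _ p∣1 = ¬prime[1] (≡.subst Prime (ℕD.∣1⇒≡1 p∣1) p-prime)
prime∤! p-prime {suc m} m<p p∣m! with euclidsLemma (suc m) (m !) p-prime p∣m!
... | inj₁ p∣1+m = ℕP.<⇒≱ m<p (ℕD.∣⇒≤ p∣1+m)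
... | inj₂ p∣m!  = prime∤! p-prime (ℕP.<-trans (ℕP.n<1+n m) m<p) p∣m!

nCk*k![n∸k]!≡n! : ∀ {n k} → k ℕ.≤ n → (n C k) ℕ.* (k ! ℕ.* (n ∸ k) !) ≡.≡ n !
nCk*k![n∸k]!≡n! {n} {k} k≤n =
  ≡.trans (≡.cong (ℕ._* (k ! ℕ.* (n ∸ k) !)) (nCk≡n!/k![n-k]! k≤n))
        (m/n*n≡m {{ℕP._!*_!≢0 k (n ∸ k)}} (k![n∸k]!∣n! k≤n))

prime∣C : ∀ {p} → Prime p → ∀ {k} → 0 < k → k < p → p ℕD.∣ p C k
prime∣C {p@(suc q)} p-prime {k} 0<k k<p
  with euclidsLemma (p C k) (k ! ℕ.* (p ∸ k) !) p-prime
         (≡.subst (p ℕD.∣_) (≡.sym (nCk*k![n∸k]!≡n! (ℕP.<⇒≤ k<p))) (ℕD.m∣m*n (q !)))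
... | inj₁ p∣pCk = p∣pCk
... | inj₂ p∣k![p∸k]! with euclidsLemma (k !) ((p ∸ k) !) p-prime p∣k![p∸k]!
... | inj₁ p∣k! = contradiction p∣k! (prime∤! p-prime k<p)
... | inj₂ p∣[p∸k]! = contradiction p∣[p∸k]! (prime∤! p-prime (ℕP.∸-monoʳ-< 0<k (ℕP.<⇒≤ k<p)))

module FreshmansDream {a ℓ} (R : CommutativeSemiring a ℓ) where

  open CommutativeSemiring R hiding (zero)
  open import Algebra.Properties.CommutativeSemiring.Binomial R using (theorem; binomialTerm)
  open import Algebra.Properties.Semiring.Exp semiring using (_^_; ^-congʳ)
  open import Algebra.Properties.CommutativeMonoid.Mult +-commutativeMonoid
    using (_×_; ×-assocˡ; ×-congˡ; ×-distrib-+)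
  open import Algebra.Properties.Monoid.Sum +-monoid using (sum; sum-init-last; sum-cong-≋)
  open import Relation.Binary.Reasoning.Setoid setoid

  ×-zeroʳ : ∀ n → n × 0# ≈ 0#
  ×-zeroʳ zero    = refl
  ×-zeroʳ (suc n) = trans (+-congˡ (×-zeroʳ n)) (+-identityʳ 0#)

  ×-distrib-sum : ∀ k {n} (w : Fin n → Carrier) → k × sum w ≈ sum (λ i → k × w i)
  ×-distrib-sum k {zero}  w = ×-zeroʳ k
  ×-distrib-sum k {suc n} w =
    trans (×-distrib-+ (w zero) _ k) (+-congˡ (×-distrib-sum k (λ i → w (suc i))))

  freshmansDream : ∀ {p} → Prime p → ∀ x y → ∃ λ W → (x + y) ^ p ≈ (x ^ p + y ^ p) + p × W
  freshmansDream {p@(suc (suc m))} p-prime x y = W , expansion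
    where
    t : Fin (suc p) → Carrier
    t = binomialTerm x y p

    k[_] : Fin (suc m) → ℕ
    k[ i ] = suc (toℕ (inject₁ i))

    p∣C : ∀ i → p ℕD.∣ p C k[ i ]
    p∣C i = prime∣C p-prime (s≤s z≤n) (s≤s (inject₁ℕ< i))

    w : Fin (suc m) → Carrier
    w i = ℕD._∣_.quotient (p∣C i) × ((x ^ k[ i ]) * (y ^ (p ∸ k[ i ])))

    W : Carrier
    W = sum w

    middle : ∀ i → t (suc (inject₁ i)) ≈ p × w i
    middle i = trans (×-congˡ (≡.trans (ℕD._∣_.equality (p∣C i)) (ℕP.*-comm q p))) (sym (×-assocˡ _ p q))
      where q = ℕD._∣_.quotient (p∣C i)

    first : t zero ≈ y ^ p
    first = trans (+-identityʳ _) (*-identityˡ _)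

    last : t (suc (fromℕ (suc m))) ≈ x ^ p
    last = lastGen _ (≡.cong suc (toℕ-fromℕ (suc m)))
      where
      lastGen : ∀ k → k ≡.≡ p → (p C k) × (x ^ k * y ^ (p ∸ k)) ≈ x ^ p
      lastGen _ ≡.refl = trans (×-congˡ (nCn≡1 p))
        (trans (+-identityʳ _) (trans (*-congˡ (^-congʳ y (ℕP.n∸n≡0 p))) (*-identityʳ _)))

    expansion : (x + y) ^ p ≈ (x ^ p + y ^ p) + p × W
    expansion = begin
      (x + y) ^ p                                        ≈⟨ theorem p x y ⟩
      t zero + sum (λ i → t (suc i))                     ≈⟨ +-cong first (sum-init-last (λ i → t (suc i))) ⟩
      y ^ p + (sum (λ i → t (suc (inject₁ i))) + t (suc (fromℕ (suc m))))
        ≈⟨ +-congˡ (+-cong (trans (sum-cong-≋ middle) (sym (×-distrib-sum p w))) last) ⟩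
      y ^ p + (p × W + x ^ p)                            ≈⟨ +-congˡ (+-comm _ _) ⟩
      y ^ p + (x ^ p + p × W)                            ≈⟨ +-assoc _ _ _ ⟨
      (y ^ p + x ^ p) + p × W                            ≈⟨ +-congʳ (+-comm _ _) ⟩
      (x ^ p + y ^ p) + p × W                            ∎

open ℤ using (ℤ; +_; -[1+_]; _+_; _*_; -_; _-_; _^_)
open ≡ using (_≡_; refl; sym; trans; cong; cong₂; subst; subst₂; module ≡-Reasoning)

-- A record around `_≡_[mod_]`, so that both sides can be inferred from the type.
infix 4 _≅_[mod_]
record _≅_[mod_] (x y : ℤ) (m : ℕ) : Set where
  constructor mod
  field divides-difference : x ≡ y [mod m ]

module _ {m : ℕ} where

  private
    infix 4 _∣ˢ_
    _∣ˢ_ = Signed._∣_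

    mod-by : ∀ {x y d} → d ≡ x - y → + m ∣ˢ d → x ≅ y [mod m ]
    mod-by d≡x-y m∣d = mod (∣⇒∣ᵤ (subst (+ m ∣ˢ_) d≡x-y m∣d))

    signed : ∀ {x y} → x ≅ y [mod m ] → + m ∣ˢ (x - y)
    signed (mod x≡y) = ∣ᵤ⇒∣ x≡y

  mod-refl : ∀ {x} → x ≅ x [mod m ]
  mod-refl {x} = mod-by (sym (ℤP.+-inverseʳ x)) (divides (+ 0) refl)

  mod-reflexive : ∀ {x y} → x ≡ y → x ≅ y [mod m ]
  mod-reflexive refl = mod-refl

  mod-sym : ∀ {x y} → x ≅ y [mod m ] → y ≅ x [mod m ]
  mod-sym {x} {y} x≅y = mod-by (lemma x y) (Signed.∣m⇒∣-m (signed x≅y))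
    where lemma : ∀ x y → - (x - y) ≡ y - x
          lemma = solve-∀

  mod-trans : ∀ {x y z} → x ≅ y [mod m ] → y ≅ z [mod m ] → x ≅ z [mod m ]
  mod-trans {x} {y} {z} x≅y y≅z = mod-by (lemma x y z) (Signed.∣m∣n⇒∣m+n (signed x≅y) (signed y≅z))
    where lemma : ∀ x y z → (x - y) + (y - z) ≡ x - z
          lemma = solve-∀

  +-cong-mod : ∀ {x y u v} → x ≅ y [mod m ] → u ≅ v [mod m ] → x + u ≅ y + v [mod m ]
  +-cong-mod {x} {y} {u} {v} x≅y u≅v = mod-by (lemma x y u v) (Signed.∣m∣n⇒∣m+n (signed x≅y) (signed u≅v))
    where lemma : ∀ x y u v → (x - y) + (u - v) ≡ (x + u) - (y + v)
          lemma = solve-∀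

  -‿cong-mod : ∀ {x y} → x ≅ y [mod m ] → - x ≅ - y [mod m ]
  -‿cong-mod {x} {y} x≅y = mod-by (lemma x y) (Signed.∣m⇒∣-m (signed x≅y))
    where lemma : ∀ x y → - (x - y) ≡ - x - - y
          lemma = solve-∀

  *-congˡ-mod : ∀ c {x y} → x ≅ y [mod m ] → c * x ≅ c * y [mod m ]
  *-congˡ-mod c {x} {y} x≅y = mod-by (lemma c x y) (Signed.∣n⇒∣m*n c (signed x≅y))
    where lemma : ∀ c x y → c * (x - y) ≡ c * x - c * y
          lemma = solve-∀

  *-congʳ-mod : ∀ c {x y} → x ≅ y [mod m ] → x * c ≅ y * c [mod m ]
  *-congʳ-mod c {x} {y} x≅y = subst₂ (_≅_[mod m ]) (ℤP.*-comm c x) (ℤP.*-comm c y) (*-congˡ-mod c x≅y)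

  +-multiple-mod : ∀ x w → x + w * + m ≅ x [mod m ]
  +-multiple-mod x w = mod-by (lemma x w (+ m)) (divides w refl)
    where lemma : ∀ x w m → w * m ≡ x + w * m - x
          lemma = solve-∀

  mod-weaken : ∀ {d x y} → d ℕD.∣ m → x ≅ y [mod m ] → x ≅ y [mod d ]
  mod-weaken {d} d∣m x≅y = mod (∣⇒∣ᵤ (Signed.∣-trans (∣ᵤ⇒∣ {+ d} {+ m} d∣m) (signed x≅y)))

  ∣-resp-mod : ∀ {x y} → x ≅ y [mod m ] → + m ℤD.∣ x → + m ℤD.∣ y
  ∣-resp-mod {x} {y} x≅y m∣x =
    ∣⇒∣ᵤ (subst (+ m ∣ˢ_) (lemma x y) (Signed.∣m∣n⇒∣m-n (∣ᵤ⇒∣ {+ m} {x} m∣x) (signed x≅y)))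
    where lemma : ∀ x y → x - (x - y) ≡ y
          lemma = solve-∀

  mod-setoid : Setoid 0ℓ 0ℓ
  mod-setoid = record
    { Carrier = ℤ
    ; _≈_ = _≅_[mod m ]
    ; isEquivalence = record { refl = mod-refl ; sym = mod-sym ; trans = mod-trans }
    }

module ModReasoning (m : ℕ) = Relation.Binary.Reasoning.Setoid (mod-setoid {m})

module _ {p : ℕ} (p-prime : Prime p) where

  private
    ℤ-semiring = CommutativeSemiring.semiring ℤP.+-*-commutativeSemiring
    open import Algebra.Properties.Semiring.Exp ℤ-semiring using () renaming (_^_ to _^ᴿ_)
    open import Algebra.Properties.Semiring.Mult ℤ-semiring using () renaming (_×_ to _×ᴿ_)
    open FreshmansDream ℤP.+-*-commutativeSemiring using (freshmansDream)

    ^ᴿ≡^ : ∀ x n → x ^ᴿ n ≡ x ^ n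
    ^ᴿ≡^ x zero    = refl
    ^ᴿ≡^ x (suc n) = cong (x *_) (^ᴿ≡^ x n)

    ×ᴿ≡* : ∀ n x → n ×ᴿ x ≡ x * + n
    ×ᴿ≡* zero    x = sym (ℤP.*-zeroʳ x)
    ×ᴿ≡* (suc n) x = begin
      x + n ×ᴿ x       ≡⟨ cong (λ z → x + z) (×ᴿ≡* n x) ⟩
      x + x * + n      ≡⟨ cong (_+ x * + n) (ℤP.*-identityʳ x) ⟨
      x * + 1 + x * + n ≡⟨ ℤP.*-distribˡ-+ x (+ 1) (+ n) ⟨
      x * + suc n      ∎
      where open ≡-Reasoning

    zero^p≡zero : (+ 0) ^ p ≡ + 0
    zero^p≡zero = zero^nonZero p {{prime⇒nonZero p-prime}}
      where zero^nonZero : ∀ n → .{{ℕ.NonZero n}} → (+ 0) ^ n ≡ + 0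
            zero^nonZero (suc _) = refl

  freshmansDreamℤ : ∀ x y → (x + y) ^ p ≅ x ^ p + y ^ p [mod p ]
  freshmansDreamℤ x y with freshmansDream p-prime x y
  ... | W , expansion = mod-trans (mod-reflexive eq) (+-multiple-mod (x ^ p + y ^ p) W)
    where
    eq : (x + y) ^ p ≡ x ^ p + y ^ p + W * + p
    eq = trans (sym (^ᴿ≡^ (x + y) p))
           (trans expansion (cong₂ _+_ (cong₂ _+_ (^ᴿ≡^ x p) (^ᴿ≡^ y p)) (×ᴿ≡* p W)))

  fermatℕ : ∀ n → (+ n) ^ p ≅ + n [mod p ]
  fermatℕ zero    = mod-reflexive zero^p≡zero
  fermatℕ (suc n) = begin
    (+ 1 + + n) ^ p          ≈⟨ freshmansDreamℤ (+ 1) (+ n) ⟩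
    (+ 1) ^ p + (+ n) ^ p    ≈⟨ +-cong-mod (mod-reflexive (ℤP.^-zeroˡ p)) (fermatℕ n) ⟩
    + 1 + + n                ∎
    where open ModReasoning p

  -- For c < 0 this follows from the case -c > 0, as (-c + c)^p = 0.
  fermat : ∀ c → c ^ p ≅ c [mod p ]
  fermat (+ n)    = fermatℕ n
  fermat c@(-[1+ n ]) = begin
    c ^ p                           ≡⟨ lemma (x ^ p) (c ^ p) ⟩
    (x ^ p + c ^ p) + - (x ^ p)     ≈⟨ +-cong-mod (mod-sym (freshmansDreamℤ x c)) (-‿cong-mod (fermatℕ (suc n))) ⟩
    (x + c) ^ p + - x               ≡⟨ cong (λ z → z ^ p + - x) (ℤP.+-inverseʳ x) ⟩
    (+ 0) ^ p + - x                 ≡⟨ cong (_+ - x) zero^p≡zero ⟩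
    + 0 + - x                       ≡⟨ ℤP.+-identityˡ (- x) ⟩
    c                               ∎
    where
    open ModReasoning p
    x = + suc n
    lemma : ∀ a b → b ≡ (a + b) + - a
    lemma = solve-∀

module _ {n : ℕ} where

  infixl 6 _⊕_ _⊖_

  _⊕_ : Vec ℤ n → Vec ℤ n → Vec ℤ n
  _⊕_ = zipWith _+_

  _⊖_ : Vec ℤ n → Vec ℤ n → Vec ℤ n
  _⊖_ = zipWith _-_

  𝟎 : Vec ℤ n
  𝟎 = replicate n (+ 0)

  scale : ℕ → Vec ℤ n → Vec ℤ n
  scale k = V.map (λ z → (+ k) * z)

  ⊕-comm : ∀ f g → f ⊕ g ≡ g ⊕ f
  ⊕-comm = VecP.zipWith-comm ℤP.+-comm

  ⊕-assoc : ∀ f g h → (f ⊕ g) ⊕ h ≡ f ⊕ (g ⊕ h)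
  ⊕-assoc = VecP.zipWith-assoc ℤP.+-assoc

  ⊕-identityˡ : ∀ f → 𝟎 ⊕ f ≡ f
  ⊕-identityˡ = VecP.zipWith-identityˡ ℤP.+-identityˡ

  scale-𝟎 : ∀ k → scale k 𝟎 ≡ 𝟎
  scale-𝟎 k = trans (VecP.map-replicate _ (+ 0) n) (cong (replicate n) (ℤP.*-zeroʳ (+ k)))

⊕-⊖-cancel : ∀ {n} (f g : Vec ℤ n) → (f ⊕ g) ⊖ f ≡ g
⊕-⊖-cancel []      []      = refl
⊕-⊖-cancel (x ∷ f) (y ∷ g) = cong₂ _∷_ (lemma x y) (⊕-⊖-cancel f g)
  where lemma : ∀ x y → x + y - x ≡ y
        lemma = solve-∀

⊖-⊕-cancel : ∀ {n} (e f : Vec ℤ n) → f ⊕ (e ⊖ f) ≡ e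
⊖-⊕-cancel []      []      = refl
⊖-⊕-cancel (z ∷ e) (x ∷ f) = cong₂ _∷_ (lemma x z) (⊖-⊕-cancel e f)
  where lemma : ∀ x z → x + (z - x) ≡ z
        lemma = solve-∀

scale-⊕ : ∀ {n} k (f g : Vec ℤ n) → scale k (f ⊕ g) ≡ scale k f ⊕ scale k g
scale-⊕ k []      []      = refl
scale-⊕ k (x ∷ f) (y ∷ g) = cong₂ _∷_ (ℤP.*-distribˡ-+ (+ k) x y) (scale-⊕ k f g)

scale-zero : ∀ {n} (f : Vec ℤ n) → scale 0 f ≡ 𝟎
scale-zero []      = refl
scale-zero (x ∷ f) = cong (+ 0 ∷_) (scale-zero f)

scale-suc : ∀ {n} k (f : Vec ℤ n) → scale (suc k) f ≡ f ⊕ scale k f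
scale-suc k []      = refl
scale-suc k (x ∷ f) = cong₂ _∷_ (lemma x) (scale-suc k f)
  where lemma : ∀ x → + suc k * x ≡ x + + k * x
        lemma x = trans (ℤP.*-distribʳ-+ x (+ 1) (+ k)) (cong (_+ + k * x) (ℤP.*-identityˡ x))

scale≡𝟎⇒≡𝟎 : ∀ {n} k .{{_ : ℕ.NonZero k}} (f : Vec ℤ n) → scale k f ≡ 𝟎 → f ≡ 𝟎
scale≡𝟎⇒≡𝟎 k []      _  = refl
scale≡𝟎⇒≡𝟎 k (x ∷ f) eq = cong₂ _∷_
  (ℤP.*-cancelˡ-≡ (+ k) x (+ 0) (trans (VecP.∷-injectiveˡ eq) (sym (ℤP.*-zeroʳ (+ k)))))
  (scale≡𝟎⇒≡𝟎 k f (VecP.∷-injectiveʳ eq))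

-- A Laurent polynomial A acts on functions h on exponents by ⟪ A , h ⟫ = Σ c · h(e) over
-- the monomials c x^e of A. Coefficients are the values on Kronecker deltas, and equality
-- of polynomials is equality of these functionals.
module _ {r : ℕ} where

  ⟪_,_⟫ : LPoly r → (Vec ℤ r → ℤ) → ℤ
  ⟪ [] , h ⟫          = + 0
  ⟪ (f , c) ∷ A , h ⟫ = c * h f + ⟪ A , h ⟫

  δ : Vec ℤ r → Vec ℤ r → ℤ
  δ e f with VecP.≡-dec ℤ._≟_ f e
  ... | yes _ = + 1
  ... | no  _ = + 0

  coeff≡⟪δ⟫ : ∀ A e → coeff A e ≡ ⟪ A , δ e ⟫
  coeff≡⟪δ⟫ []            e = refl
  coeff≡⟪δ⟫ ((f , c) ∷ A) e with VecP.≡-dec ℤ._≟_ f e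
  ... | yes _ = cong₂ _+_ (sym (ℤP.*-identityʳ c)) (coeff≡⟪δ⟫ A e)
  ... | no  _ = trans (coeff≡⟪δ⟫ A e)
                  (sym (trans (cong (_+ ⟪ A , δ e ⟫) (ℤP.*-zeroʳ c)) (ℤP.+-identityˡ _)))

  ⟪⟫-cong : ∀ A {h k} → (∀ f → h f ≡ k f) → ⟪ A , h ⟫ ≡ ⟪ A , k ⟫
  ⟪⟫-cong []            h≗k = refl
  ⟪⟫-cong ((f , c) ∷ A) h≗k = cong₂ (λ u v → c * u + v) (h≗k f) (⟪⟫-cong A h≗k)

  ⟪⟫-++ : ∀ A B h → ⟪ A ++ B , h ⟫ ≡ ⟪ A , h ⟫ + ⟪ B , h ⟫
  ⟪⟫-++ []            B h = sym (ℤP.+-identityˡ _)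
  ⟪⟫-++ ((f , c) ∷ A) B h =
    trans (cong (λ z → c * h f + z) (⟪⟫-++ A B h)) (sym (ℤP.+-assoc (c * h f) _ _))

  ⟪⟫-zero : ∀ A → ⟪ A , (λ _ → + 0) ⟫ ≡ + 0
  ⟪⟫-zero []            = refl
  ⟪⟫-zero ((f , c) ∷ A) = cong₂ _+_ (ℤP.*-zeroʳ c) (⟪⟫-zero A)

  ⟪⟫-+ : ∀ A h k → ⟪ A , (λ f → h f + k f) ⟫ ≡ ⟪ A , h ⟫ + ⟪ A , k ⟫
  ⟪⟫-+ []            h k = refl
  ⟪⟫-+ ((f , c) ∷ A) h k =
    trans (cong (λ z → c * (h f + k f) + z) (⟪⟫-+ A h k)) (lemma c (h f) (k f) _ _)
    where lemma : ∀ c x y u v → c * (x + y) + (u + v) ≡ (c * x + u) + (c * y + v)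
          lemma = solve-∀

  ⟪⟫-* : ∀ A a h → ⟪ A , (λ f → a * h f) ⟫ ≡ a * ⟪ A , h ⟫
  ⟪⟫-* []            a h = sym (ℤP.*-zeroʳ a)
  ⟪⟫-* ((f , c) ∷ A) a h =
    trans (cong (λ z → c * (a * h f) + z) (⟪⟫-* A a h)) (lemma c a (h f) _)
    where lemma : ∀ c a x u → c * (a * x) + a * u ≡ a * (c * x + u)
          lemma = solve-∀

  ⟪⟫-swap : ∀ A B (k : Vec ℤ r → Vec ℤ r → ℤ) →
            ⟪ A , (λ f → ⟪ B , k f ⟫) ⟫ ≡ ⟪ B , (λ g → ⟪ A , (λ f → k f g) ⟫) ⟫
  ⟪⟫-swap []            B k = sym (⟪⟫-zero B)
  ⟪⟫-swap ((f , c) ∷ A) B k = begin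
    c * ⟪ B , k f ⟫ + ⟪ A , (λ f → ⟪ B , k f ⟫) ⟫
      ≡⟨ cong₂ _+_ (sym (⟪⟫-* B c (k f))) (⟪⟫-swap A B k) ⟩
    ⟪ B , (λ g → c * k f g) ⟫ + ⟪ B , (λ g → ⟪ A , (λ f → k f g) ⟫) ⟫
      ≡⟨ sym (⟪⟫-+ B _ _) ⟩
    ⟪ B , (λ g → c * k f g + ⟪ A , (λ f → k f g) ⟫) ⟫ ∎
    where open ≡-Reasoning

  ⟪⟫-monomial· : ∀ f c B h → ⟪ ((f , c) ∷ []) · B , h ⟫ ≡ c * ⟪ B , (λ g → h (f ⊕ g)) ⟫
  ⟪⟫-monomial· f c []            h = sym (ℤP.*-zeroʳ c)
  ⟪⟫-monomial· f c ((g , d) ∷ B) h =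
    trans (cong (λ z → c * d * h (f ⊕ g) + z) (⟪⟫-monomial· f c B h)) (lemma c d (h (f ⊕ g)) _)
    where lemma : ∀ c d x u → c * d * x + c * u ≡ c * (d * x + u)
          lemma = solve-∀

  -- `((f , c) ∷ A) · B` unfolds to `map _ B ++ A · B`, and `((f , c) ∷ []) · B` to `map _ B ++ []`.
  ⟪⟫-++-[] : ∀ A B h → ⟪ A ++ B , h ⟫ ≡ ⟪ A ++ [] , h ⟫ + ⟪ B , h ⟫
  ⟪⟫-++-[] A B h = trans (⟪⟫-++ A B h)
    (cong (_+ ⟪ B , h ⟫) (sym (trans (⟪⟫-++ A [] h) (ℤP.+-identityʳ ⟪ A , h ⟫))))

  ⟪⟫-· : ∀ A B h → ⟪ A · B , h ⟫ ≡ ⟪ A , (λ f → ⟪ B , (λ g → h (f ⊕ g)) ⟫) ⟫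
  ⟪⟫-· []            B h = refl
  ⟪⟫-· ((f , c) ∷ A) B h =
    trans (⟪⟫-++-[] (map _ B) (A · B) h) (cong₂ _+_ (⟪⟫-monomial· f c B h) (⟪⟫-· A B h))

  ⟪⟫-subsPow : ∀ k A h → ⟪ subsPow k A , h ⟫ ≡ ⟪ A , (λ f → h (scale k f)) ⟫
  ⟪⟫-subsPow k []            h = refl
  ⟪⟫-subsPow k ((f , c) ∷ A) h = cong (λ z → c * h (scale k f) + z) (⟪⟫-subsPow k A h)

  infix 4 _≈_
  _≈_ : LPoly r → LPoly r → Set
  A ≈ B = ∀ h → ⟪ A , h ⟫ ≡ ⟪ B , h ⟫

  ≈⇒coeff≡ : ∀ {A B} → A ≈ B → ∀ e → coeff A e ≡ coeff B e
  ≈⇒coeff≡ {A} {B} A≈B e = trans (coeff≡⟪δ⟫ A e) (trans (A≈B (δ e)) (sym (coeff≡⟪δ⟫ B e)))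

  ·-cong : ∀ {A A′ B B′} → A ≈ A′ → B ≈ B′ → A · B ≈ A′ · B′
  ·-cong {A} {A′} {B} {B′} A≈A′ B≈B′ h = begin
    ⟪ A · B , h ⟫                                  ≡⟨ ⟪⟫-· A B h ⟩
    ⟪ A , (λ f → ⟪ B , (λ g → h (f ⊕ g)) ⟫) ⟫      ≡⟨ A≈A′ _ ⟩
    ⟪ A′ , (λ f → ⟪ B , (λ g → h (f ⊕ g)) ⟫) ⟫     ≡⟨ ⟪⟫-cong A′ (λ f → B≈B′ _) ⟩
    ⟪ A′ , (λ f → ⟪ B′ , (λ g → h (f ⊕ g)) ⟫) ⟫    ≡⟨ ⟪⟫-· A′ B′ h ⟨
    ⟪ A′ · B′ , h ⟫                                ∎
    where open ≡-Reasoning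

  ·-comm : ∀ A B → A · B ≈ B · A
  ·-comm A B h = begin
    ⟪ A · B , h ⟫                                  ≡⟨ ⟪⟫-· A B h ⟩
    ⟪ A , (λ f → ⟪ B , (λ g → h (f ⊕ g)) ⟫) ⟫      ≡⟨ ⟪⟫-swap A B _ ⟩
    ⟪ B , (λ g → ⟪ A , (λ f → h (f ⊕ g)) ⟫) ⟫      ≡⟨ ⟪⟫-cong B (λ g → ⟪⟫-cong A (λ f → cong h (⊕-comm f g))) ⟩
    ⟪ B , (λ g → ⟪ A , (λ f → h (g ⊕ f)) ⟫) ⟫      ≡⟨ ⟪⟫-· B A h ⟨
    ⟪ B · A , h ⟫                                  ∎
    where open ≡-Reasoning

  ·-assoc : ∀ A B D → (A · B) · D ≈ A · (B · D)
  ·-assoc A B D h = begin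
    ⟪ (A · B) · D , h ⟫
      ≡⟨ ⟪⟫-· (A · B) D h ⟩
    ⟪ A · B , (λ u → ⟪ D , (λ w → h (u ⊕ w)) ⟫) ⟫
      ≡⟨ ⟪⟫-· A B _ ⟩
    ⟪ A , (λ f → ⟪ B , (λ g → ⟪ D , (λ w → h ((f ⊕ g) ⊕ w)) ⟫) ⟫) ⟫
      ≡⟨ ⟪⟫-cong A (λ f → ⟪⟫-cong B (λ g → ⟪⟫-cong D (λ w → cong h (⊕-assoc f g w)))) ⟩
    ⟪ A , (λ f → ⟪ B , (λ g → ⟪ D , (λ w → h (f ⊕ (g ⊕ w))) ⟫) ⟫) ⟫
      ≡⟨ ⟪⟫-cong A (λ f → ⟪⟫-· B D _) ⟨
    ⟪ A , (λ f → ⟪ B · D , (λ v → h (f ⊕ v)) ⟫) ⟫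
      ≡⟨ ⟪⟫-· A (B · D) h ⟨
    ⟪ A · (B · D) , h ⟫ ∎
    where open ≡-Reasoning

  ·-identityˡ : ∀ A → one · A ≈ A
  ·-identityˡ A h = begin
    ⟪ one · A , h ⟫                            ≡⟨ ⟪⟫-· one A h ⟩
    + 1 * ⟪ A , (λ g → h (𝟎 ⊕ g)) ⟫ + + 0      ≡⟨ ℤP.+-identityʳ _ ⟩
    + 1 * ⟪ A , (λ g → h (𝟎 ⊕ g)) ⟫            ≡⟨ ℤP.*-identityˡ _ ⟩
    ⟪ A , (λ g → h (𝟎 ⊕ g)) ⟫                  ≡⟨ ⟪⟫-cong A (λ g → cong h (⊕-identityˡ g)) ⟩
    ⟪ A , h ⟫                                  ∎
    where open ≡-Reasoning

  ·-distribʳ : ∀ A B D → (B ++ D) · A ≈ (B · A) ++ (D · A)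
  ·-distribʳ A B D h = begin
    ⟪ (B ++ D) · A , h ⟫                  ≡⟨ ⟪⟫-· (B ++ D) A h ⟩
    ⟪ B ++ D , _ ⟫                        ≡⟨ ⟪⟫-++ B D _ ⟩
    ⟪ B , _ ⟫ + ⟪ D , _ ⟫                 ≡⟨ cong₂ _+_ (⟪⟫-· B A h) (⟪⟫-· D A h) ⟨
    ⟪ B · A , h ⟫ + ⟪ D · A , h ⟫         ≡⟨ ⟪⟫-++ (B · A) (D · A) h ⟨
    ⟪ (B · A) ++ (D · A) , h ⟫            ∎
    where open ≡-Reasoning

  commutativeSemiring : CommutativeSemiring 0ℓ 0ℓ
  commutativeSemiring = record
    { isCommutativeSemiring = IsCommutativeSemiringˡ.isCommutativeSemiring (record
      { +-isCommutativeMonoid = ++-isCommutativeMonoid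
      ; *-isCommutativeMonoid = ·-isCommutativeMonoid
      ; distribʳ = ·-distribʳ
      ; zeroˡ = λ A h → refl
      })
    }
    where
    ≈-isEquivalence : IsEquivalence _≈_
    ≈-isEquivalence = record
      { refl = λ h → refl ; sym = λ A≈B h → sym (A≈B h) ; trans = λ A≈B B≈D h → trans (A≈B h) (B≈D h) }

    ++-isCommutativeMonoid : IsCommutativeMonoid _≈_ _++_ []
    ++-isCommutativeMonoid = record
      { isMonoid = record
        { isSemigroup = record
          { isMagma = record
            { isEquivalence = ≈-isEquivalence
            ; ∙-cong = λ {A} {A′} {B} {B′} A≈A′ B≈B′ h →
                trans (⟪⟫-++ A B h) (trans (cong₂ _+_ (A≈A′ h) (B≈B′ h)) (sym (⟪⟫-++ A′ B′ h)))
            }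
          ; assoc = λ A B D h → cong (λ xs → ⟪ xs , h ⟫) (ListP.++-assoc A B D)
          }
        ; identity = (λ A h → refl) , (λ A h → cong (λ xs → ⟪ xs , h ⟫) (ListP.++-identityʳ A))
        }
      ; comm = λ A B h → trans (⟪⟫-++ A B h) (trans (ℤP.+-comm ⟪ A , h ⟫ ⟪ B , h ⟫) (sym (⟪⟫-++ B A h)))
      }

    ·-isCommutativeMonoid : IsCommutativeMonoid _≈_ _·_ one
    ·-isCommutativeMonoid = record
      { isMonoid = record
        { isSemigroup = record
          { isMagma = record { isEquivalence = ≈-isEquivalence ; ∙-cong = λ {A} {A′} {B} {B′} → ·-cong {A} {A′} {B} {B′} }
          ; assoc = ·-assoc
          }
        ; identity = ·-identityˡ , (λ A h → trans (·-comm A one h) (·-identityˡ A h))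
        }
      ; comm = ·-comm
      }

  private
    semiring = CommutativeSemiring.semiring commutativeSemiring
  open import Algebra.Properties.Semiring.Exp semiring using (^-assocʳ) renaming (_^_ to _^ᴾ_)
  open import Algebra.Properties.Semiring.Mult semiring using () renaming (_×_ to _×ᴾ_)

  ^ᴾ≡^^ : ∀ A n → A ^ᴾ n ≡ A ^^ n
  ^ᴾ≡^^ A zero    = refl
  ^ᴾ≡^^ A (suc n) = cong (A ·_) (^ᴾ≡^^ A n)

  ⟪⟫-×ᴾ : ∀ n W h → ⟪ n ×ᴾ W , h ⟫ ≡ ⟪ W , h ⟫ * + n
  ⟪⟫-×ᴾ zero    W h = sym (ℤP.*-zeroʳ ⟪ W , h ⟫)
  ⟪⟫-×ᴾ (suc n) W h = begin
    ⟪ W ++ n ×ᴾ W , h ⟫                      ≡⟨ ⟪⟫-++ W (n ×ᴾ W) h ⟩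
    ⟪ W , h ⟫ + ⟪ n ×ᴾ W , h ⟫               ≡⟨ cong (λ z → ⟪ W , h ⟫ + z) (⟪⟫-×ᴾ n W h) ⟩
    ⟪ W , h ⟫ + ⟪ W , h ⟫ * + n              ≡⟨ cong (_+ ⟪ W , h ⟫ * + n) (ℤP.*-identityʳ ⟪ W , h ⟫) ⟨
    ⟪ W , h ⟫ * + 1 + ⟪ W , h ⟫ * + n        ≡⟨ ℤP.*-distribˡ-+ ⟪ W , h ⟫ (+ 1) (+ n) ⟨
    ⟪ W , h ⟫ * + suc n                      ∎
    where open ≡-Reasoning

  ^^-*-assoc : ∀ A m n → (A ^^ m) ^^ n ≈ A ^^ (m ℕ.* n)
  ^^-*-assoc A m n h = begin
    ⟪ (A ^^ m) ^^ n , h ⟫         ≡⟨ cong (λ X → ⟪ X ^^ n , h ⟫) (^ᴾ≡^^ A m) ⟨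
    ⟪ (A ^ᴾ m) ^^ n , h ⟫         ≡⟨ cong (λ X → ⟪ X , h ⟫) (^ᴾ≡^^ (A ^ᴾ m) n) ⟨
    ⟪ (A ^ᴾ m) ^ᴾ n , h ⟫         ≡⟨ ^-assocʳ A m n h ⟩
    ⟪ A ^ᴾ (m ℕ.* n) , h ⟫        ≡⟨ cong (λ X → ⟪ X , h ⟫) (^ᴾ≡^^ A (m ℕ.* n)) ⟩
    ⟪ A ^^ (m ℕ.* n) , h ⟫        ∎
    where open ≡-Reasoning

  subsPow-· : ∀ k A B → subsPow k (A · B) ≈ subsPow k A · subsPow k B
  subsPow-· k A B h = begin
    ⟪ subsPow k (A · B) , h ⟫
      ≡⟨ ⟪⟫-subsPow k (A · B) h ⟩
    ⟪ A · B , (λ f → h (scale k f)) ⟫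
      ≡⟨ ⟪⟫-· A B _ ⟩
    ⟪ A , (λ f → ⟪ B , (λ g → h (scale k (f ⊕ g))) ⟫) ⟫
      ≡⟨ ⟪⟫-cong A (λ f → ⟪⟫-cong B (λ g → cong h (scale-⊕ k f g))) ⟩
    ⟪ A , (λ f → ⟪ B , (λ g → h (scale k f ⊕ scale k g)) ⟫) ⟫
      ≡⟨ ⟪⟫-cong A (λ f → ⟪⟫-subsPow k B _) ⟨
    ⟪ A , (λ f → ⟪ subsPow k B , (λ g → h (scale k f ⊕ g)) ⟫) ⟫
      ≡⟨ ⟪⟫-subsPow k A _ ⟨
    ⟪ subsPow k A , (λ f → ⟪ subsPow k B , (λ g → h (f ⊕ g)) ⟫) ⟫
      ≡⟨ ⟪⟫-· (subsPow k A) (subsPow k B) h ⟨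
    ⟪ subsPow k A · subsPow k B , h ⟫ ∎
    where open ≡-Reasoning

  subsPow-^^ : ∀ k A n → subsPow k (A ^^ n) ≈ subsPow k A ^^ n
  subsPow-^^ k A zero    h = cong (λ f → + 1 * h f + + 0) (scale-𝟎 k)
  subsPow-^^ k A (suc n) h = trans (subsPow-· k A (A ^^ n) h)
    (·-cong {subsPow k A} {subsPow k A} {subsPow k (A ^^ n)} {subsPow k A ^^ n} (λ _ → refl) (subsPow-^^ k A n) h)

  -- Only the zero exponent is sent to zero by a nonzero dilation.
  ct-subsPow : ∀ k .{{_ : ℕ.NonZero k}} A → ct (subsPow k A) ≡ ct A
  ct-subsPow k A = begin
    coeff (subsPow k A) 𝟎              ≡⟨ coeff≡⟪δ⟫ (subsPow k A) 𝟎 ⟩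
    ⟪ subsPow k A , δ 𝟎 ⟫              ≡⟨ ⟪⟫-subsPow k A (δ 𝟎) ⟩
    ⟪ A , (λ f → δ 𝟎 (scale k f)) ⟫    ≡⟨ ⟪⟫-cong A δ𝟎∘scale≡δ𝟎 ⟩
    ⟪ A , δ 𝟎 ⟫                        ≡⟨ coeff≡⟪δ⟫ A 𝟎 ⟨
    coeff A 𝟎                          ∎
    where
    open ≡-Reasoning
    δ𝟎∘scale≡δ𝟎 : ∀ f → δ 𝟎 (scale k f) ≡ δ 𝟎 f
    δ𝟎∘scale≡δ𝟎 f with VecP.≡-dec ℤ._≟_ (scale k f) 𝟎 | VecP.≡-dec ℤ._≟_ f 𝟎
    ... | yes _       | yes _    = refl
    ... | no  _       | no  _    = refl
    ... | yes kf≡𝟎    | no  f≢𝟎  = contradiction (scale≡𝟎⇒≡𝟎 k f kf≡𝟎) f≢𝟎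
    ... | no  kf≢𝟎    | yes refl = contradiction (scale-𝟎 k) kf≢𝟎

  infix 4 _≋_[mod_]
  _≋_[mod_] : LPoly r → LPoly r → ℕ → Set
  A ≋ B [mod m ] = ∀ e → coeff A e ≅ coeff B e [mod m ]

  δ-⊕ : ∀ e f g → δ e (f ⊕ g) ≡ δ (e ⊖ f) g
  δ-⊕ e f g with VecP.≡-dec ℤ._≟_ (f ⊕ g) e | VecP.≡-dec ℤ._≟_ g (e ⊖ f)
  ... | yes _      | yes _      = refl
  ... | no  _      | no  _      = refl
  ... | yes f⊕g≡e  | no  g≢e⊖f  = contradiction (trans (sym (⊕-⊖-cancel f g)) (cong (_⊖ f) f⊕g≡e)) g≢e⊖f
  ... | no  f⊕g≢e  | yes g≡e⊖f  = contradiction (trans (cong (f ⊕_) g≡e⊖f) (⊖-⊕-cancel e f)) f⊕g≢e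

  coeff-· : ∀ A B e → coeff (A · B) e ≡ ⟪ A , (λ f → coeff B (e ⊖ f)) ⟫
  coeff-· A B e = begin
    coeff (A · B) e                                 ≡⟨ coeff≡⟪δ⟫ (A · B) e ⟩
    ⟪ A · B , δ e ⟫                                 ≡⟨ ⟪⟫-· A B (δ e) ⟩
    ⟪ A , (λ f → ⟪ B , (λ g → δ e (f ⊕ g)) ⟫) ⟫     ≡⟨ ⟪⟫-cong A (λ f → ⟪⟫-cong B (δ-⊕ e f)) ⟩
    ⟪ A , (λ f → ⟪ B , δ (e ⊖ f) ⟫) ⟫               ≡⟨ ⟪⟫-cong A (λ f → coeff≡⟪δ⟫ B (e ⊖ f)) ⟨
    ⟪ A , (λ f → coeff B (e ⊖ f)) ⟫                 ∎
    where open ≡-Reasoning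

  ⟪⟫-cong-mod : ∀ {m} A {h k} → (∀ f → h f ≅ k f [mod m ]) → ⟪ A , h ⟫ ≅ ⟪ A , k ⟫ [mod m ]
  ⟪⟫-cong-mod []            h≅k = mod-refl
  ⟪⟫-cong-mod ((f , c) ∷ A) h≅k = +-cong-mod (*-congˡ-mod c (h≅k f)) (⟪⟫-cong-mod A h≅k)

  ·-congˡ-mod : ∀ {m} A {B B′} → B ≋ B′ [mod m ] → A · B ≋ A · B′ [mod m ]
  ·-congˡ-mod A {B} {B′} B≋B′ e = subst₂ (_≅_[mod _ ]) (sym (coeff-· A B e)) (sym (coeff-· A B′ e))
    (⟪⟫-cong-mod A (λ f → B≋B′ (e ⊖ f)))

  ·-cong-mod : ∀ {m A A′ B B′} → A ≋ A′ [mod m ] → B ≋ B′ [mod m ] → A · B ≋ A′ · B′ [mod m ]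
  ·-cong-mod {m} {A} {A′} {B} {B′} A≋A′ B≋B′ e = begin
    coeff (A · B) e      ≈⟨ ·-congˡ-mod A B≋B′ e ⟩
    coeff (A · B′) e     ≡⟨ ≈⇒coeff≡ {A · B′} {B′ · A} (·-comm A B′) e ⟩
    coeff (B′ · A) e     ≈⟨ ·-congˡ-mod B′ A≋A′ e ⟩
    coeff (B′ · A′) e    ≡⟨ ≈⇒coeff≡ {B′ · A′} {A′ · B′} (·-comm B′ A′) e ⟩
    coeff (A′ · B′) e    ∎
    where open ModReasoning m

  ^^-cong-mod : ∀ {m A B} → A ≋ B [mod m ] → ∀ n → A ^^ n ≋ B ^^ n [mod m ]
  ^^-cong-mod A≋B zero    e = mod-refl
  ^^-cong-mod {m} {A} {B} A≋B (suc n) = ·-cong-mod {m} {A} {B} {A ^^ n} {B ^^ n} A≋B (^^-cong-mod A≋B n)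

  ⟪⟫-monomial^^ : ∀ f c n h → ⟪ ((f , c) ∷ []) ^^ n , h ⟫ ≡ c ^ n * h (scale n f)
  ⟪⟫-monomial^^ f c zero    h = trans (ℤP.+-identityʳ _) (cong (λ g → + 1 * h g) (sym (scale-zero f)))
  ⟪⟫-monomial^^ f c (suc n) h = begin
    ⟪ ((f , c) ∷ []) · (((f , c) ∷ []) ^^ n) , h ⟫
      ≡⟨ ⟪⟫-· ((f , c) ∷ []) (((f , c) ∷ []) ^^ n) h ⟩
    c * ⟪ ((f , c) ∷ []) ^^ n , (λ g → h (f ⊕ g)) ⟫ + + 0
      ≡⟨ ℤP.+-identityʳ _ ⟩
    c * ⟪ ((f , c) ∷ []) ^^ n , (λ g → h (f ⊕ g)) ⟫
      ≡⟨ cong (c *_) (⟪⟫-monomial^^ f c n (λ g → h (f ⊕ g))) ⟩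
    c * (c ^ n * h (f ⊕ scale n f))
      ≡⟨ ℤP.*-assoc c (c ^ n) _ ⟨
    c ^ suc n * h (f ⊕ scale n f)
      ≡⟨ cong (λ g → c ^ suc n * h g) (scale-suc n f) ⟨
    c ^ suc n * h (scale (suc n) f) ∎
    where open ≡-Reasoning

  open FreshmansDream commutativeSemiring using (freshmansDream)

  -- The freshman's dream splits off the first monomial, whose coefficient is handled by Fermat.
  frobenius : ∀ {p} → Prime p → ∀ A → A ^^ p ≋ subsPow p A [mod p ]
  frobenius {p} p-prime [] e = mod-reflexive (cong (λ X → coeff X e) ([]^^ p {{prime⇒nonZero p-prime}}))
    where []^^ : ∀ n .{{_ : ℕ.NonZero n}} → [] ^^ n ≡ []
          []^^ (suc n) = refl
  frobenius {p} p-prime ((f , c) ∷ A) e with freshmansDream p-prime ((f , c) ∷ []) A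
  ... | W , expansion = begin
    coeff (((f , c) ∷ A) ^^ p) e
      ≡⟨ trans (coeff≡⟪δ⟫ (((f , c) ∷ A) ^^ p) e) (cong (λ X → ⟪ X , δ e ⟫) (sym (^ᴾ≡^^ ((f , c) ∷ A) p))) ⟩
    ⟪ ((f , c) ∷ A) ^ᴾ p , δ e ⟫
      ≡⟨ expansion (δ e) ⟩
    ⟪ (T ^ᴾ p ++ A ^ᴾ p) ++ p ×ᴾ W , δ e ⟫
      ≡⟨ ⟪⟫-++ (T ^ᴾ p ++ A ^ᴾ p) (p ×ᴾ W) (δ e) ⟩
    ⟪ T ^ᴾ p ++ A ^ᴾ p , δ e ⟫ + ⟪ p ×ᴾ W , δ e ⟫
      ≡⟨ cong₂ _+_ (⟪⟫-++ (T ^ᴾ p) (A ^ᴾ p) (δ e)) (⟪⟫-×ᴾ p W (δ e)) ⟩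
    ⟪ T ^ᴾ p , δ e ⟫ + ⟪ A ^ᴾ p , δ e ⟫ + ⟪ W , δ e ⟫ * + p
      ≡⟨ cong (_+ ⟪ W , δ e ⟫ * + p) (cong₂ _+_ (cong (λ X → ⟪ X , δ e ⟫) (^ᴾ≡^^ T p))
           (trans (cong (λ X → ⟪ X , δ e ⟫) (^ᴾ≡^^ A p)) (sym (coeff≡⟪δ⟫ (A ^^ p) e)))) ⟩
    ⟪ T ^^ p , δ e ⟫ + coeff (A ^^ p) e + ⟪ W , δ e ⟫ * + p
      ≈⟨ +-multiple-mod _ ⟪ W , δ e ⟫ ⟩
    ⟪ T ^^ p , δ e ⟫ + coeff (A ^^ p) e
      ≡⟨ cong (_+ coeff (A ^^ p) e) (⟪⟫-monomial^^ f c p (δ e)) ⟩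
    c ^ p * δ e (scale p f) + coeff (A ^^ p) e
      ≈⟨ +-cong-mod (*-congʳ-mod _ (fermat p-prime c)) (frobenius p-prime A e) ⟩
    c * δ e (scale p f) + coeff (subsPow p A) e
      ≡⟨ trans (cong (λ z → c * δ e (scale p f) + z) (coeff≡⟪δ⟫ (subsPow p A) e))
               (sym (coeff≡⟪δ⟫ (subsPow p ((f , c) ∷ A)) e)) ⟩
    coeff (subsPow p ((f , c) ∷ A)) e ∎
    where
    open ModReasoning p
    T = (f , c) ∷ []

  ct-^^-transfer : ∀ {d} m k .{{_ : ℕ.NonZero k}} {P Q} → P ^^ m ≋ subsPow k Q [mod d ] →
                   ∀ n → ct (P ^^ (m ℕ.* n)) ≅ ct (Q ^^ n) [mod d ]
  ct-^^-transfer {d} m k {P} {Q} P^m≋Q[xᵏ] n = begin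
    ct (P ^^ (m ℕ.* n))           ≡⟨ ≈⇒coeff≡ {(P ^^ m) ^^ n} {P ^^ (m ℕ.* n)} (^^-*-assoc P m n) 𝟎 ⟨
    ct ((P ^^ m) ^^ n)            ≈⟨ ^^-cong-mod P^m≋Q[xᵏ] n 𝟎 ⟩
    ct (subsPow k Q ^^ n)         ≡⟨ ≈⇒coeff≡ {subsPow k (Q ^^ n)} {subsPow k Q ^^ n} (subsPow-^^ k Q n) 𝟎 ⟨
    ct (subsPow k (Q ^^ n))       ≡⟨ ct-subsPow k (Q ^^ n) ⟩
    ct (Q ^^ n)                   ∎
    where open ModReasoning d

  ct-^^-p^j* : ∀ {p} → Prime p → ∀ P j n → ct (P ^^ (p ℕ.^ j ℕ.* n)) ≅ ct (P ^^ n) [mod p ]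
  ct-^^-p^j* p-prime P zero    n = mod-reflexive (cong (λ k → ct (P ^^ k)) (ℕP.*-identityˡ n))
  ct-^^-p^j* {p} p-prime P (suc j) n = begin
    ct (P ^^ (p ℕ.* p ℕ.^ j ℕ.* n))    ≡⟨ cong (λ k → ct (P ^^ k)) (ℕP.*-assoc p (p ℕ.^ j) n) ⟩
    ct (P ^^ (p ℕ.* (p ℕ.^ j ℕ.* n)))  ≈⟨ ct-^^-transfer p p {{prime⇒nonZero p-prime}} (frobenius p-prime P) _ ⟩
    ct (P ^^ (p ℕ.^ j ℕ.* n))          ≈⟨ ct-^^-p^j* p-prime P j n ⟩
    ct (P ^^ n)                        ∎
    where open ModReasoning p

  ct-^^-tilde : ∀ {p} → Prime p → ∀ {a} → 1 ℕ.≤ a → ∀ (P : LPoly r) ℓ P̃ → ReprAt p a P ℓ P̃ →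
                ∀ n → ct (P ^^ n) ≅ ct (P̃ ^^ n) [mod p ]
  ct-^^-tilde {p} p-prime {suc a} _ P ℓ P̃ repr n = begin
    ct (P ^^ n)                  ≈⟨ ct-^^-p^j* p-prime P a n ⟨
    ct (P ^^ (p ℕ.^ a ℕ.* n))    ≈⟨ mod-weaken (ℕD.m∣m*n (p ℕ.^ a)) P^[p^a*n]≅P̃^n ⟩
    ct (P̃ ^^ n)                  ∎
    where
    open ModReasoning p
    P^[p^a*n]≅P̃^n : ct (P ^^ (p ℕ.^ a ℕ.* n)) ≅ ct (P̃ ^^ n) [mod p ℕ.^ suc a ]
    P^[p^a*n]≅P̃^n = ct-^^-transfer (p ℕ.^ a) (p ℕ.^ ℓ) {{ℕP.m^n≢0 p ℓ {{prime⇒nonZero p-prime}}}} {P} {P̃} (λ e → mod (repr e)) n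

open import Data.Nat using (_≤_)
open import Data.Integer.Divisibility using (_∣_)
open import Data.Product using (_×_)

lemma22 : (r : ℕ) (P : LPoly r) (p : ℕ) → Prime p → (a : ℕ) → 1 ≤ a →
    (ℓ : ℕ) (Pt : LPoly r) → IsTilde p a P ℓ Pt →
    ((∃ λ (n₀ : ℕ) → (+ p) ∣ ct (P ^^ n₀)) ⇔ (∃ λ (n₁ : ℕ) → (+ p) ∣ ct (Pt ^^ n₁)))
    × (∀ (n₀ : ℕ) → (+ p) ∣ ct (P ^^ n₀) → (+ p) ∣ ct (Pt ^^ n₀))
lemma22 r P p p-prime a 1≤a ℓ Pt (repr , _) =
  mk⇔ (λ (n , p∣ct) → n , P→P̃ n p∣ct) (λ (n , p∣ct) → n , P̃→P n p∣ct) , P→P̃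
  where
  P→P̃ : ∀ n → (+ p) ∣ ct (P ^^ n) → (+ p) ∣ ct (Pt ^^ n)
  P→P̃ n = ∣-resp-mod (ct-^^-tilde p-prime 1≤a P ℓ Pt repr n)
  P̃→P : ∀ n → (+ p) ∣ ct (Pt ^^ n) → (+ p) ∣ ct (P ^^ n)
  P̃→P n = ∣-resp-mod (mod-sym (ct-^^-tilde p-prime 1≤a P ℓ Pt repr n))
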